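{- Let $G$ be a 2-connected outerplanar near-triangulation on $k$ vertices $v_1,\dots,v_k$, and let $v_k,v_1,v_2$ form a path on the outer cycle of $G$. Then $P(G-\overrightarrow{v_kv_1v_2})$ contains no (non-vanishing) monomial of the form $v_1^0v_2^0v_k^0\prod_{i=3}^{k-1}v_i^{\alpha_i}$ with all $\alpha_i\le2$.
   Context: For a graph $G$, vertices are also variables and $P(G)=\prod_{uv\in E(G),\,u<v}(u-v)$ for a fixed arbitrary orientation. A monomial is contained in $P(G)$ if its coefficient is nonzero. A 2-connected outerplanar near-triangulation is a 2-connected outerplanar graph embedded with all vertices on the outer cycle and all bounded faces triangles. $G-\overrightarrow{v_kv_1v_2}$ is $G$ with edges $v_kv_1,v_1v_2$ deleted (vertices kept). -}

module Defs where

open import Data.Nat as ℕ using (ℕ; zero; suc; _+_)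
open import Data.Integer as ℤ using (ℤ; +_; -[1+_])
open import Data.Fin as Fin using (Fin; toℕ)
open import Data.Bool using (Bool; true; false; _∧_; _∨_; not; if_then_else_)
open import Data.Bool.Properties using (∧-comm; ∨-comm)
open import Data.List as List using (List; []; _∷_; allFin; concatMap; foldr; filterᵇ)
open import Data.Vec as Vec using (Vec; tabulate; zipWith; replicate)
open import Data.Vec.Properties using (≡-dec)
open import Data.Product using (_×_; _,_; Σ; ∃; ∃-syntax)
open import Data.Sum using (_⊎_)
open import Relation.Nullary using (¬_; Dec; yes; no)
open import Relation.Nullary.Decidable using (⌊_⌋)
open import Relation.Binary.PropositionalEquality using (_≡_; _≢_; refl; cong; cong₂)
open import Function.Definitions using (Injective)

record Graph (k : ℕ) : Set where
  field
    adj    : Fin k → Fin k → Bool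
    sym    : ∀ u v → adj u v ≡ adj v u
    irrefl : ∀ u → adj u u ≡ false
open Graph public

_==_ : ∀ {k} → Fin k → Fin k → Bool
u == v = ⌊ u Fin.≟ v ⌋

samePair : ∀ {k} → Fin k → Fin k → Fin k → Fin k → Bool
samePair u v x y = ((u == x) ∧ (v == y)) ∨ ((u == y) ∧ (v == x))

samePair-sym : ∀ {k} (u v x y : Fin k) → samePair u v x y ≡ samePair v u x y
samePair-sym u v x y rewrite ∧-comm (u == x) (v == y) | ∧-comm (u == y) (v == x)
  = ∨-comm (v == y ∧ u == x) (v == x ∧ u == y)

deletePath : ∀ {k} → Graph k → Fin k → Fin k → Fin k → Graph k
deletePath {k} G a b c = record
  { adj = adj'
  ; sym = λ u v → cong₂ (λ p q → p ∧ not (q)) (sym G u v)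
                    (cong₂ _∨_ (samePair-sym u v a b) (samePair-sym u v b c))
  ; irrefl = λ u → cong (λ p → p ∧ not (samePair u u a b ∨ samePair u u b c)) (irrefl G u)
  }
  where
  adj' : Fin k → Fin k → Bool
  adj' u v = adj G u v ∧ not (samePair u v a b ∨ samePair u v b c)

-- Outerplanar near-triangulations, combinatorially.
-- pos v = position of vertex v on the outer (Hamiltonian) cycle,
-- the vertices being placed in convex position in this cyclic order.

module _ {k : ℕ} (pos : Fin k → Fin k) where

  Consecutive : Fin k → Fin k → Set
  Consecutive p q = (toℕ q ≡ suc (toℕ p)) ⊎ ((suc (toℕ p) ≡ k) × (toℕ q ≡ 0))

  CycleNeighbours : Fin k → Fin k → Set
  CycleNeighbours u v = Consecutive (pos u) (pos v) ⊎ Consecutive (pos v) (pos u)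

  Interleave : Fin k → Fin k → Fin k → Fin k → Set
  Interleave a b c d = (pos a Fin.< pos c) × (pos c Fin.< pos b) × (pos b Fin.< pos d)

  Cross : Fin k → Fin k → Fin k → Fin k → Set
  Cross a b c d = Interleave a b c d ⊎ Interleave b a c d ⊎ Interleave a b d c
                ⊎ Interleave b a d c ⊎ Interleave c d a b ⊎ Interleave d c a b
                ⊎ Interleave c d b a ⊎ Interleave d c b a

  record IsOuterplanarNearTriangulation (G : Graph k) : Set where
    field
      atLeast3     : 3 ℕ.≤ k
      pos-injective : Injective _≡_ _≡_ pos
      outerCycle   : ∀ u v → CycleNeighbours u v → adj G u v ≡ true
      noCrossing   : ∀ a b c d → adj G a b ≡ true → adj G c d ≡ true → ¬ Cross a b c d
      -- every bounded face is a triangle: the chord set is maximal, i.e.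
      -- every non-adjacent pair of distinct vertices is separated by an edge
      triangulated : ∀ a b → a ≢ b → adj G a b ≡ false →
                     ∃[ c ] ∃[ d ] (adj G c d ≡ true × Cross a b c d)

-- Multivariate polynomials over ℤ in variables Fin k (unnormalised term lists)

Monomial : ℕ → Set
Monomial k = Vec ℕ k

Poly : ℕ → Set
Poly k = List (ℤ × Monomial k)

onePoly : ∀ {k} → Poly k
onePoly {k} = (+ 1 , replicate k 0) ∷ []

var : ∀ {k} → Fin k → Monomial k
var u = tabulate (λ j → if j == u then 1 else 0)

_*P_ : ∀ {k} → Poly k → Poly k → Poly k
p *P q = concatMap (λ { (a , m) → List.map (λ { (b , n) → (a ℤ.* b , zipWith _+_ m n) }) q }) p

coeff : ∀ {k} → Poly k → Monomial k → ℤ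
coeff [] α = + 0
coeff ((c , m) ∷ p) α with ≡-dec ℕ._≟_ m α
... | yes _ = c ℤ.+ coeff p α
... | no  _ = coeff p α

edges : ∀ {k} → Graph k → List (Fin k × Fin k)
edges {k} G = concatMap (λ u → List.map (u ,_) (filterᵇ (λ v → ⌊ u Fin.<? v ⌋ ∧ adj G u v) (allFin k))) (allFin k)

graphPoly : ∀ {k} → Graph k → Poly k
graphPoly G = foldr (λ { (u , v) p → ((+ 1 , var u) ∷ (-[1+ 0 ] , var v) ∷ []) *P p }) onePoly (edges G)

{-# OPTIONS --safe #-}
-- P(H) is a product of |E(H)| linear forms, so every monomial it contains has degree |E(H)|.
-- Number the vertices of G by their positions 0, …, k − 1 on the outer cycle.  Besides the
-- k − 1 edges {i, i + 1}, every inner vertex m yields the edge joining its leftmost and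
-- rightmost neighbours: an edge separating these two would cross an edge at m or contradict
-- their extremality, so by maximality they are adjacent.  Two inner vertices m < m′ with the
-- same ends would give crossing edges (left end)–m′ and m–(right end).  So G has at least
-- 2k − 3 edges and G − v_k v_1 v_2 at least 2k − 5, while the monomials in question have
-- degree at most 2(k − 3).

module Submission where

open import Defs
open import Data.Nat using (ℕ; _≤_; _+_)
open import Data.Integer using (+_)
import Data.Fin as Fin
open Fin using (Fin; fromℕ)
open import Data.Vec using (lookup)
open import Relation.Binary.PropositionalEquality using (_≡_)

open import Data.Bool using (Bool; true; false; T; _∧_; if_then_else_)
open import Data.Bool.Properties using (T-≡; T-∧; T-∨; ∧-identityʳ)
open import Data.Empty using (⊥; ⊥-elim)
import Data.Fin.Properties as Fin
import Data.Integer as ℤ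
open import Data.List as List using (List; []; _∷_; length; allFin)
open import Data.List.Membership.Propositional using (_∈_)
open import Data.List.Membership.Propositional.Properties
  using (∈-concatMap⁺; ∈-concatMap⁻; ∈-map⁺; ∈-map⁻; ∈-filter⁺; ∈-filter⁻; ∈-allFin)
open import Data.List.Relation.Binary.Subset.Propositional using (_⊆_)
open import Data.List.Relation.Unary.All using (All; []; _∷_)
open import Data.List.Relation.Unary.All.Properties using (concat⁺; gmap⁺)
open import Data.List.Relation.Unary.Any using (here; there)
import Data.List.Relation.Unary.Any as Any
import Data.List.Relation.Unary.Any.Properties as Any
open import Data.Nat as ℕ using (zero; suc; _<_; z≤n; s≤s; s≤s⁻¹; s<s; s<s⁻¹)
import Data.Nat.Properties as ℕ
open import Algebra.Properties.CommutativeSemigroup ℕ.+-commutativeSemigroup using (interchange)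
open import Data.Product as Product using (_×_; _,_; proj₁; proj₂; ∃-syntax)
open import Data.Sum as Sum using (_⊎_; inj₁; inj₂)
open import Data.Vec as Vec using (Vec; []; _∷_; tabulate; zipWith; replicate)
open import Data.Vec.Properties using (≡-dec; tabulate-cong)
open import Function using (_∘_; Injective)
open import Function.Bundles using (Equivalence; Injection)
open import Function.Properties.Inverse using (↔⇒↣)
open import Relation.Binary using (tri<; tri≈; tri>)
import Relation.Binary.PropositionalEquality as ≡
open ≡ using (_≢_; refl; trans; cong; cong₂; subst; subst₂; module ≡-Reasoning)
open import Relation.Nullary using (Dec; yes; no; ¬_; contradiction)
open import Relation.Nullary.Decidable using (⌊_⌋; T?; toWitness; fromWitness)

degree : ∀ {k} → Monomial k → ℕ
degree = Vec.sum

degree-zipWith : ∀ {k} (m m′ : Monomial k) → degree (zipWith _+_ m m′) ≡ degree m + degree m′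
degree-zipWith []      []        = refl
degree-zipWith (x ∷ m) (x′ ∷ m′) =
  trans (cong (_+_ (x + x′)) (degree-zipWith m m′)) (interchange x x′ (degree m) (degree m′))

degree-replicate-0 : ∀ k → degree (replicate k 0) ≡ 0
degree-replicate-0 zero    = refl
degree-replicate-0 (suc k) = degree-replicate-0 k

degree-tabulate-0 : ∀ k → degree (tabulate {n = k} (λ _ → 0)) ≡ 0
degree-tabulate-0 zero    = refl
degree-tabulate-0 (suc k) = degree-tabulate-0 k

suc==suc : ∀ {k} (i j : Fin k) → (Fin.suc i == Fin.suc j) ≡ (i == j)
suc==suc i j with i Fin.≟ j
... | yes _ = refl
... | no  _ = refl

degree-var : ∀ {k} (u : Fin k) → degree (var u) ≡ 1
degree-var {suc k} Fin.zero    = cong suc (degree-tabulate-0 k)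
degree-var {suc k} (Fin.suc u) =
  trans (cong degree (tabulate-cong (λ j → cong (if_then 1 else 0) (suc==suc j u))))
        (degree-var u)

Homogeneous : ∀ {k} → ℕ → Poly k → Set
Homogeneous d = All (λ term → degree (proj₂ term) ≡ d)

*P-homogeneous : ∀ {k d e} {p q : Poly k} → Homogeneous d p → Homogeneous e q →
                 Homogeneous (d + e) (p *P q)
*P-homogeneous hp hq = concat⁺ (gmap⁺ (λ { {_ , m} dm →
  gmap⁺ (λ { {_ , m′} dm′ → trans (degree-zipWith m m′) (cong₂ _+_ dm dm′) }) hq }) hp)

edgeFactor : ∀ {k} → Fin k → Fin k → Poly k
edgeFactor u v = (+ 1 , var u) ∷ (ℤ.-[1+ 0 ] , var v) ∷ []

edgeFactor-homogeneous : ∀ {k} (u v : Fin k) → Homogeneous 1 (edgeFactor u v)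
edgeFactor-homogeneous u v = degree-var u ∷ degree-var v ∷ []

graphPoly-homogeneous : ∀ {k} (G : Graph k) → Homogeneous (length (edges G)) (graphPoly G)
graphPoly-homogeneous {k} G = go (edges G)
  where
  go : ∀ es → Homogeneous (length es) (List.foldr (λ { (u , v) p → edgeFactor u v *P p }) onePoly es)
  go []             = degree-replicate-0 k ∷ []
  go ((u , v) ∷ es) = *P-homogeneous (edgeFactor-homogeneous u v) (go es)

coeff-homogeneous : ∀ {k d} {p : Poly k} → Homogeneous d p →
                    ∀ α → degree α ≢ d → coeff p α ≡ + 0
coeff-homogeneous []                     α α≢d = refl
coeff-homogeneous {p = (_ , m) ∷ p} (dm ∷ hp) α α≢d with ≡-dec ℕ._≟_ m α
... | yes refl = contradiction dm α≢d
... | no  _    = coeff-homogeneous hp α α≢d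

sum≤*-lastZero : ∀ {c} n (v : Vec ℕ (suc n)) → lookup v (fromℕ n) ≡ 0 →
                 (∀ i → lookup v i ≤ c) → Vec.sum v ≤ n ℕ.* c
sum≤*-lastZero zero    (.0 ∷ []) refl _   = z≤n
sum≤*-lastZero (suc n) (x ∷ v)   last≡0 v≤c =
  ℕ.+-mono-≤ (v≤c Fin.zero) (sum≤*-lastZero n v last≡0 (v≤c ∘ Fin.suc))

injective⇒≤length : ∀ {a} {A : Set a} {M} {xs : List A} (f : Fin M → A) →
                     Injective _≡_ _≡_ f → (∀ i → f i ∈ xs) → M ≤ length xs
injective⇒≤length {xs = xs} f f-injective f∈xs = Fin.injective⇒≤ index-injective
  where
  index-injective : Injective _≡_ _≡_ (Any.index ∘ f∈xs)
  index-injective {i} {j} eq = f-injective (begin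
    f i                                  ≡⟨ Any.lookup-index (f∈xs i) ⟩
    List.lookup xs (Any.index (f∈xs i))  ≡⟨ cong (List.lookup xs) eq ⟩
    List.lookup xs (Any.index (f∈xs j))  ≡⟨ Any.lookup-index (f∈xs j) ⟨
    f j                                  ∎)
    where open ≡-Reasoning

sortPair : ∀ {k} → Fin k → Fin k → Fin k × Fin k
sortPair u v = if ⌊ u Fin.<? v ⌋ then (u , v) else (v , u)

module _ {k} {u v : Fin k} (u<v : u Fin.< v) where

  sortPair-ordered : sortPair u v ≡ (u , v)
  sortPair-ordered with u Fin.<? v
  ... | yes _   = refl
  ... | no  u≮v = contradiction u<v u≮v

  sortPair-reversed : sortPair v u ≡ (u , v)
  sortPair-reversed with v Fin.<? u
  ... | yes v<u = contradiction u<v (Fin.<-asym v<u)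
  ... | no  _   = refl

sortPair-injective : ∀ {k} {u v u′ v′ : Fin k} → sortPair u v ≡ sortPair u′ v′ →
                     (u ≡ u′ × v ≡ v′) ⊎ (u ≡ v′ × v ≡ u′)
sortPair-injective {u = u} {v} {u′} {v′} eq with u Fin.<? v | u′ Fin.<? v′
... | yes _ | yes _ = inj₁ (cong proj₁ eq , cong proj₂ eq)
... | yes _ | no  _ = inj₂ (cong proj₁ eq , cong proj₂ eq)
... | no  _ | yes _ = inj₂ (cong proj₂ eq , cong proj₁ eq)
... | no  _ | no  _ = inj₁ (cong proj₂ eq , cong proj₁ eq)

samePair-sound : ∀ {k} {u v x y : Fin k} → samePair u v x y ≡ true →
                 (u ≡ x × v ≡ y) ⊎ (u ≡ y × v ≡ x)
samePair-sound eq = Sum.map bothEqual bothEqual (Equivalence.to T-∨ (Equivalence.from T-≡ eq))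
  where
  bothEqual : ∀ {k} {a b c d : Fin k} → T ((a == b) ∧ (c == d)) → a ≡ b × c ≡ d
  bothEqual {a = a} {b} {c} {d} p with Equivalence.to (T-∧ {a == b} {c == d}) p
  ... | a≡b , c≡d = toWitness {a? = a Fin.≟ b} a≡b , toWitness {a? = c Fin.≟ d} c≡d

samePair⇒sortPair : ∀ {k} {u v x y : Fin k} → u Fin.< v → samePair u v x y ≡ true →
                    (u , v) ≡ sortPair x y
samePair⇒sortPair {u = u} {v} {x} {y} u<v eq with samePair-sound {u = u} {v} {x} {y} eq
... | inj₁ (refl , refl) = ≡.sym (sortPair-ordered u<v)
... | inj₂ (refl , refl) = ≡.sym (sortPair-reversed u<v)

module _ {k} (G : Graph k) where

  private
    forwardEdge? : Fin k → Fin k → Bool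
    forwardEdge? u w = ⌊ u Fin.<? w ⌋ ∧ adj G u w

  ∈-edges⁺ : ∀ {u v} → u Fin.< v → adj G u v ≡ true → (u , v) ∈ edges G
  ∈-edges⁺ {u} {v} u<v uv =
    ∈-concatMap⁺ _ (Any.map (λ { refl → ∈-map⁺ (u ,_) v∈ }) (∈-allFin u))
    where
    v∈ : v ∈ List.filterᵇ (forwardEdge? u) (allFin k)
    v∈ = ∈-filter⁺ (T? ∘ forwardEdge? u) (∈-allFin v)
           (Equivalence.from T-∧ (fromWitness u<v , Equivalence.from T-≡ uv))

  ∈-edges⁻ : ∀ {u v} → (u , v) ∈ edges G → u Fin.< v × adj G u v ≡ true
  ∈-edges⁻ uv∈ with Any.satisfied (∈-concatMap⁻ _ {xs = allFin k} uv∈)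
  ... | u , uv∈row with ∈-map⁻ (u ,_) uv∈row
  ... | v , v∈ , refl
    with Equivalence.to (T-∧ {⌊ u Fin.<? v ⌋}) (proj₂ (∈-filter⁻ (T? ∘ forwardEdge? u) {xs = allFin k} v∈))
  ...   | u<v , uv = toWitness {a? = u Fin.<? v} u<v , Equivalence.to T-≡ uv

  sortPair∈edges : ∀ {u v} → u ≢ v → adj G u v ≡ true → sortPair u v ∈ edges G
  sortPair∈edges {u} {v} u≢v uv with Fin.<-cmp u v
  ... | tri< u<v _ _ = subst (_∈ edges G) (≡.sym (sortPair-ordered u<v)) (∈-edges⁺ u<v uv)
  ... | tri≈ _ u≡v _ = contradiction u≡v u≢v
  ... | tri> _ _ v<u =
    subst (_∈ edges G) (≡.sym (sortPair-reversed v<u)) (∈-edges⁺ v<u (trans (Graph.sym G v u) uv))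

adj-deletePath : ∀ {k} (G : Graph k) {a b c u v} →
                 samePair u v a b ≡ false → samePair u v b c ≡ false →
                 adj (deletePath G a b c) u v ≡ adj G u v
adj-deletePath G {u = u} {v} ab bc rewrite ab | bc = ∧-identityʳ (adj G u v)

edges-deletePath : ∀ {k} (G : Graph k) a b c →
                   edges G ⊆ sortPair a b ∷ sortPair b c ∷ edges (deletePath G a b c)
edges-deletePath G a b c {u , v} uv∈
  with ∈-edges⁻ G uv∈ | samePair u v a b in ab | samePair u v b c in bc
... | u<v , _  | true  | _     = here (samePair⇒sortPair u<v ab)
... | u<v , _  | false | true  = there (here (samePair⇒sortPair u<v bc))
... | u<v , uv | false | false =
  there (there (∈-edges⁺ (deletePath G a b c) u<v (trans (adj-deletePath G ab bc) uv)))

least : (ℕ → Bool) → ℕ → ℕ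
least P zero    = zero
least P (suc n) = if P zero then zero else suc (least (P ∘ suc) n)

least-spec : ∀ P n {x} → x < n → P x ≡ true → P (least P n) ≡ true × least P n ≤ x
least-spec P (suc n) {x} x<n Px with P zero in P0
... | true = P0 , z≤n
least-spec P (suc n) {zero}  x<n Px | false = contradiction (trans (≡.sym P0) Px) λ ()
least-spec P (suc n) {suc x} x<n Px | false =
  Product.map₂ s≤s (least-spec (P ∘ suc) n (s<s⁻¹ x<n) Px)

greatest : (ℕ → Bool) → ℕ → ℕ
greatest P zero    = zero
greatest P (suc n) = if P n then n else greatest P n

greatest-spec : ∀ P n {y} → y < n → P y ≡ true → P (greatest P n) ≡ true × y ≤ greatest P n
greatest-spec P (suc n) y<n Py with P n in Pn
... | true = Pn , s≤s⁻¹ y<n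
... | false with ℕ.m≤n⇒m<n∨m≡n (s≤s⁻¹ y<n)
...   | inj₁ y<n′ = greatest-spec P n y<n′ Py
...   | inj₂ refl = contradiction (trans (≡.sym Pn) Py) λ ()

Separates : ℕ → ℕ → ℕ → ℕ → Set
Separates a b x y = a < x × x < b × (y < a ⊎ b < y)

-- Vertices are identified with their positions on the outer cycle; only the outer path
-- 0, 1, …, K − 1 is required, not the closing edge.
record ConvexNearTriangulation (K : ℕ) : Set where
  field
    E         : ℕ → ℕ → Bool
    E-sym     : ∀ x y → E x y ≡ E y x
    E-bounded : ∀ {x y} → E x y ≡ true → y < K
    E-path    : ∀ {x} → suc x < K → E x (suc x) ≡ true
    E-planar  : ∀ {a b c d} → E a b ≡ true → E c d ≡ true → a < c → c < b → b < d → ⊥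
    E-maximal : ∀ {a b} → a < b → b < K → E a b ≡ false →
                ∃[ x ] ∃[ y ] E x y ≡ true × Separates a b x y

OrderedBelow : ℕ → ℕ × ℕ → Set
OrderedBelow K (a , b) = a < b × b < K

module Spans {n} (T : ConvexNearTriangulation (2 + n)) where
  open ConvexNearTriangulation T

  leftmost rightmost : ℕ → ℕ
  leftmost m  = least (λ x → E x m) (2 + n)
  rightmost m = greatest (E m) (2 + n)

  leftmost-spec : ∀ {x m} → E x m ≡ true → E (leftmost m) m ≡ true × leftmost m ≤ x
  leftmost-spec {x} {m} xm = least-spec (λ x → E x m) (2 + n) (E-bounded (trans (E-sym m x) xm)) xm

  rightmost-spec : ∀ {m y} → E m y ≡ true → E m (rightmost m) ≡ true × y ≤ rightmost m
  rightmost-spec {m} my = greatest-spec (E m) (2 + n) (E-bounded my) my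

  module _ {t} (t<n : t < n) where

    leftmost-adj : E (leftmost (suc t)) (suc t) ≡ true
    leftmost-adj = proj₁ (leftmost-spec (E-path (s<s (ℕ.m<n⇒m<1+n t<n))))

    leftmost< : leftmost (suc t) < suc t
    leftmost< = s≤s (proj₂ (leftmost-spec (E-path (s<s (ℕ.m<n⇒m<1+n t<n)))))

    rightmost-adj : E (suc t) (rightmost (suc t)) ≡ true
    rightmost-adj = proj₁ (rightmost-spec (E-path (s<s (s<s t<n))))

    <rightmost : suc t < rightmost (suc t)
    <rightmost = proj₂ (rightmost-spec (E-path (s<s (s<s t<n))))

    span-uncrossed : ∀ {x y} → E x y ≡ true → ¬ Separates (leftmost (suc t)) (rightmost (suc t)) x y
    span-uncrossed {x} {y} xy (lo<x , x<hi , outside) with ℕ.<-cmp x (suc t) | outside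
    ... | tri≈ _ refl _ | inj₁ y<lo = ℕ.<⇒≱ y<lo (proj₂ (leftmost-spec (trans (E-sym y x) xy)))
    ... | tri≈ _ refl _ | inj₂ hi<y = ℕ.<⇒≱ hi<y (proj₂ (rightmost-spec xy))
    ... | tri< x<m _ _  | inj₁ y<lo = E-planar (trans (E-sym y x) xy) leftmost-adj y<lo lo<x x<m
    ... | tri< x<m _ _  | inj₂ hi<y = E-planar leftmost-adj xy lo<x x<m (ℕ.<-trans <rightmost hi<y)
    ... | tri> _ _ m<x  | inj₁ y<lo =
      E-planar (trans (E-sym y x) xy) rightmost-adj (ℕ.<-trans y<lo leftmost<) m<x x<hi
    ... | tri> _ _ m<x  | inj₂ hi<y = E-planar rightmost-adj xy m<x x<hi hi<y

    span-adj : E (leftmost (suc t)) (rightmost (suc t)) ≡ true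
    span-adj with E (leftmost (suc t)) (rightmost (suc t)) in lo-hi
    ... | true  = refl
    ... | false with E-maximal (ℕ.<-trans leftmost< <rightmost) (E-bounded rightmost-adj) lo-hi
    ...   | x , y , xy , separates = ⊥-elim (span-uncrossed xy separates)

    span-wide : suc (leftmost (suc t)) < rightmost (suc t)
    span-wide = ℕ.≤-<-trans leftmost< <rightmost

  spans-nested : ∀ {t t′} (t<n : t < n) (t′<n : t′ < n) → t < t′ →
                 leftmost (suc t) ≡ leftmost (suc t′) →
                 rightmost (suc t) ≡ rightmost (suc t′) → ⊥
  spans-nested t<n t′<n t<t′ lo≡ hi≡ =
    E-planar (leftmost-adj t′<n) (rightmost-adj t<n)
      (subst (_< _) lo≡ (leftmost< t<n)) (s<s t<t′) (subst (_ <_) (≡.sym hi≡) (<rightmost t′<n))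

  span-injective : ∀ {t t′} (t<n : t < n) (t′<n : t′ < n) →
                   leftmost (suc t) ≡ leftmost (suc t′) →
                   rightmost (suc t) ≡ rightmost (suc t′) → t ≡ t′
  span-injective t<n t′<n lo≡ hi≡ = ℕ.≤-antisym
    (ℕ.≮⇒≥ λ t′<t → spans-nested t′<n t<n t′<t (≡.sym lo≡) (≡.sym hi≡))
    (ℕ.≮⇒≥ λ t<t′ → spans-nested t<n t′<n t<t′ lo≡ hi≡)

  IsEdge : ℕ × ℕ → Set
  IsEdge (a , b) = OrderedBelow (2 + n) (a , b) × E a b ≡ true

  edge : Fin (1 + n) ⊎ Fin n → ℕ × ℕ
  edge (inj₁ i) = Fin.toℕ i , suc (Fin.toℕ i)
  edge (inj₂ j) = leftmost (suc (Fin.toℕ j)) , rightmost (suc (Fin.toℕ j))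

  edge-isEdge : ∀ s → IsEdge (edge s)
  edge-isEdge (inj₁ i) = (ℕ.n<1+n _ , s<s (Fin.toℕ<n i)) , E-path (s<s (Fin.toℕ<n i))
  edge-isEdge (inj₂ j) =
    (ℕ.<-trans (leftmost< j<n) (<rightmost j<n) , E-bounded (rightmost-adj j<n)) , span-adj j<n
    where
    j<n : Fin.toℕ j < n
    j<n = Fin.toℕ<n j

  edge-injective : Injective _≡_ _≡_ edge
  edge-injective {inj₁ i} {inj₁ i′} eq = cong inj₁ (Fin.toℕ-injective (cong proj₁ eq))
  edge-injective {inj₁ i} {inj₂ j}  eq =
    contradiction (trans (cong suc (≡.sym (cong proj₁ eq))) (cong proj₂ eq))
                  (ℕ.<⇒≢ (span-wide (Fin.toℕ<n j)))
  edge-injective {inj₂ j} {inj₁ i}  eq =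
    contradiction (trans (cong suc (cong proj₁ eq)) (≡.sym (cong proj₂ eq)))
                  (ℕ.<⇒≢ (span-wide (Fin.toℕ<n j)))
  edge-injective {inj₂ j} {inj₂ j′} eq = cong inj₂ (Fin.toℕ-injective
    (span-injective (Fin.toℕ<n j) (Fin.toℕ<n j′) (cong proj₁ eq) (cong proj₂ eq)))

injective⇒surjective : ∀ {k} {f : Fin k → Fin k} → Injective _≡_ _≡_ f →
                       ∀ p → ∃[ u ] f u ≡ p
injective⇒surjective {suc k} {f} f-injective p with Fin.any? (λ u → f u Fin.≟ p)
... | yes hit = hit
... | no  miss = contradiction (Fin.injective⇒≤ punchOut-injective) ℕ.1+n≰n
  where
  p≢f : ∀ u → p ≢ f u
  p≢f u p≡fu = miss (u , ≡.sym p≡fu)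

  punchOut-injective : Injective _≡_ _≡_ (λ u → Fin.punchOut (p≢f u))
  punchOut-injective eq = f-injective (Fin.punchOut-injective (p≢f _) (p≢f _) eq)


module _ {k} (pos : Fin k → Fin k) where

  private
    P : Fin k → ℕ
    P = Fin.toℕ ∘ pos

  cross⇒separates : ∀ {u v c d} → P u < P v → Cross pos u v c d →
                    Separates (P u) (P v) (P c) (P d) ⊎ Separates (P u) (P v) (P d) (P c)
  cross⇒separates uv (inj₁ (uc , cv , vd))                                     = inj₁ (uc , cv , inj₂ vd)
  cross⇒separates uv (inj₂ (inj₂ (inj₁ (ud , dv , vc))))                       = inj₂ (ud , dv , inj₂ vc)
  cross⇒separates uv (inj₂ (inj₂ (inj₂ (inj₂ (inj₁ (cu , ud , dv))))))         = inj₂ (ud , dv , inj₁ cu)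
  cross⇒separates uv (inj₂ (inj₂ (inj₂ (inj₂ (inj₂ (inj₁ (du , uc , cv))))))) = inj₁ (uc , cv , inj₁ du)
  cross⇒separates uv (inj₂ (inj₁ (vc , cu , _)))
    = ⊥-elim (ℕ.<-asym uv (ℕ.<-trans vc cu))
  cross⇒separates uv (inj₂ (inj₂ (inj₂ (inj₁ (vd , du , _)))))
    = ⊥-elim (ℕ.<-asym uv (ℕ.<-trans vd du))
  cross⇒separates uv (inj₂ (inj₂ (inj₂ (inj₂ (inj₂ (inj₂ (inj₁ (_ , vd , du))))))))
    = ⊥-elim (ℕ.<-asym uv (ℕ.<-trans vd du))
  cross⇒separates uv (inj₂ (inj₂ (inj₂ (inj₂ (inj₂ (inj₂ (inj₂ (_ , vc , cu))))))))
    = ⊥-elim (ℕ.<-asym uv (ℕ.<-trans vc cu))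

module Positions {k} {G : Graph k} {pos : Fin k → Fin k} (ont : IsOuterplanarNearTriangulation pos G) where
  open IsOuterplanarNearTriangulation ont

  vertexAt : Fin k → Fin k
  vertexAt p = proj₁ (injective⇒surjective pos-injective p)

  pos-vertexAt : ∀ p → pos (vertexAt p) ≡ p
  pos-vertexAt p = proj₂ (injective⇒surjective pos-injective p)

  at : ∀ {x} → .(x < k) → Fin k
  at x<k = vertexAt (Fin.fromℕ< x<k)

  position-at : ∀ {x} .(x<k : x < k) → Fin.toℕ (pos (at x<k)) ≡ x
  position-at x<k = trans (cong Fin.toℕ (pos-vertexAt _)) (Fin.toℕ-fromℕ< x<k)

  at-pos : ∀ u → at (Fin.toℕ<n (pos u)) ≡ u
  at-pos u = pos-injective (trans (pos-vertexAt _) (Fin.fromℕ<-toℕ (pos u) (Fin.toℕ<n (pos u))))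

  at-injective : ∀ {x y} .(x<k : x < k) .(y<k : y < k) → at x<k ≡ at y<k → x ≡ y
  at-injective {x} {y} x<k y<k eq =
    trans (≡.sym (position-at x<k)) (trans (cong (Fin.toℕ ∘ pos) eq) (position-at y<k))

  private
    P : Fin k → ℕ
    P = Fin.toℕ ∘ pos

    adjAt : ∀ {x y} → Dec (x < k) → Dec (y < k) → Bool
    adjAt (yes x<k) (yes y<k) = adj G (at x<k) (at y<k)
    adjAt _         _         = false

  -- Positions ≥ k are isolated.
  E : ℕ → ℕ → Bool
  E x y = adjAt (x ℕ.<? k) (y ℕ.<? k)

  E-at : ∀ {x y} (x<k : x < k) (y<k : y < k) → E x y ≡ adj G (at x<k) (at y<k)
  E-at {x} {y} x<k y<k with x ℕ.<? k | y ℕ.<? k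
  ... | yes _   | yes _   = refl
  ... | no  x≮k | _       = contradiction x<k x≮k
  ... | yes _   | no  y≮k = contradiction y<k y≮k

  E-pos : ∀ u v → E (P u) (P v) ≡ adj G u v
  E-pos u v = trans (E-at (Fin.toℕ<n (pos u)) (Fin.toℕ<n (pos v))) (cong₂ (adj G) (at-pos u) (at-pos v))

  E-inRange : ∀ {x y} → E x y ≡ true → x < k × y < k
  E-inRange {x} {y} xy with x ℕ.<? k | y ℕ.<? k
  ... | yes x<k | yes y<k = x<k , y<k

  E-sym : ∀ x y → E x y ≡ E y x
  E-sym x y with x ℕ.<? k | y ℕ.<? k
  ... | yes _ | yes _ = Graph.sym G _ _
  ... | yes _ | no  _ = refl
  ... | no  _ | yes _ = refl
  ... | no  _ | no  _ = refl

  E-path : ∀ {x} → suc x < k → E x (suc x) ≡ true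
  E-path {x} x+1<k = trans (E-at x<k x+1<k) (outerCycle _ _ (inj₁ (inj₁ consecutive)))
    where
    x<k : x < k
    x<k = ℕ.<-trans (ℕ.n<1+n x) x+1<k
    consecutive : P (at x+1<k) ≡ suc (P (at x<k))
    consecutive = trans (position-at x+1<k) (cong suc (≡.sym (position-at x<k)))

  E-planar : ∀ {a b c d} → E a b ≡ true → E c d ≡ true → a < c → c < b → b < d → ⊥
  E-planar ab cd a<c c<b b<d with E-inRange ab | E-inRange cd
  ... | a<k , b<k | c<k , d<k = noCrossing (at a<k) (at b<k) (at c<k) (at d<k)
    (trans (≡.sym (E-at a<k b<k)) ab) (trans (≡.sym (E-at c<k d<k)) cd)
    (inj₁ (ordered a<k c<k a<c , ordered c<k b<k c<b , ordered b<k d<k b<d))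
    where
    ordered : ∀ {x y} (x<k : x < k) (y<k : y < k) → x < y → pos (at x<k) Fin.< pos (at y<k)
    ordered x<k y<k = subst₂ _<_ (≡.sym (position-at x<k)) (≡.sym (position-at y<k))

  E-maximal : ∀ {a b} → a < b → b < k → E a b ≡ false →
              ∃[ x ] ∃[ y ] E x y ≡ true × Separates a b x y
  E-maximal {a} {b} a<b b<k ab = separating
    (triangulated (at a<k) (at b<k) (ℕ.<⇒≢ a<b ∘ at-injective a<k b<k) (trans (≡.sym (E-at a<k b<k)) ab))
    where
    a<k : a < k
    a<k = ℕ.<-trans a<b b<k

    onPositions : ∀ {x y} → Separates (P (at a<k)) (P (at b<k)) x y → Separates a b x y
    onPositions = subst₂ (λ a b → Separates a b _ _) (position-at a<k) (position-at b<k)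

    separating : (∃[ c ] ∃[ d ] adj G c d ≡ true × Cross pos (at a<k) (at b<k) c d) →
                 ∃[ x ] ∃[ y ] E x y ≡ true × Separates a b x y
    separating (c , d , cd , cross)
      with cross⇒separates pos
             (subst₂ _<_ (≡.sym (position-at a<k)) (≡.sym (position-at b<k)) a<b) cross
    ... | inj₁ cd-separates = P c , P d , trans (E-pos c d) cd , onPositions cd-separates
    ... | inj₂ dc-separates =
      P d , P c , trans (E-pos d c) (trans (Graph.sym G d c) cd) , onPositions dc-separates

  convex : ConvexNearTriangulation k
  convex = record
    { E = E ; E-sym = E-sym ; E-bounded = proj₂ ∘ E-inRange ; E-path = E-path
    ; E-planar = E-planar ; E-maximal = E-maximal }

  toVertices : (e : ℕ × ℕ) → OrderedBelow k e → Fin k × Fin k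
  toVertices (a , b) (a<b , b<k) = sortPair (at (ℕ.<-trans a<b b<k)) (at b<k)

  toVertices-injective : ∀ {e e′} (o : OrderedBelow k e) (o′ : OrderedBelow k e′) →
                         toVertices e o ≡ toVertices e′ o′ → e ≡ e′
  toVertices-injective {a , b} {a′ , b′} (a<b , b<k) (a′<b′ , b′<k) eq with sortPair-injective eq
  ... | inj₁ (a≡a′ , b≡b′) = cong₂ _,_ (at-injective _ _ a≡a′) (at-injective b<k b′<k b≡b′)
  ... | inj₂ (a≡b′ , b≡a′) =
    contradiction (subst₂ _<_ (at-injective _ b′<k a≡b′) (at-injective b<k _ b≡a′) a<b) (ℕ.<-asym a′<b′)

  toVertices∈edges : ∀ {e} (o : OrderedBelow k e) → E (proj₁ e) (proj₂ e) ≡ true →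
                     toVertices e o ∈ edges G
  toVertices∈edges {a , b} (a<b , b<k) ab = sortPair∈edges G
    (ℕ.<⇒≢ a<b ∘ at-injective _ b<k) (trans (≡.sym (E-at (ℕ.<-trans a<b b<k) b<k)) ab)

deletePath-edgeCount : ∀ {n} {G : Graph (2 + n)} {pos} → IsOuterplanarNearTriangulation pos G →
                       ∀ a b c → (1 + n) + n ≤ 2 + length (edges (deletePath G a b c))
deletePath-edgeCount {n} {G} ont a b c =
  injective⇒≤length {xs = sortPair a b ∷ sortPair b c ∷ edges (deletePath G a b c)}
    (vertexEdge ∘ split)
    -- η-expanded: otherwise Agda infers the implicit arguments by unfolding vertexEdge, which takes minutes.
    (λ {i} {j} → split-injective {i} {j} ∘ vertexEdge-injective)
    (edges-deletePath G a b c ∘ vertexEdge∈edges ∘ split)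
  where
  open Positions ont
  open Spans convex

  split : Fin ((1 + n) + n) → Fin (1 + n) ⊎ Fin n
  split = Fin.splitAt (1 + n)

  split-injective : Injective _≡_ _≡_ split
  split-injective = Injection.injective (↔⇒↣ Fin.+↔⊎)

  vertexEdge : Fin (1 + n) ⊎ Fin n → Fin (2 + n) × Fin (2 + n)
  vertexEdge s = toVertices (edge s) (proj₁ (edge-isEdge s))

  vertexEdge-injective : ∀ {s s′} → vertexEdge s ≡ vertexEdge s′ → s ≡ s′
  vertexEdge-injective {s} {s′} =
    edge-injective {s} {s′} ∘
    toVertices-injective {edge s} {edge s′} (proj₁ (edge-isEdge s)) (proj₁ (edge-isEdge s′))

  vertexEdge∈edges : ∀ s → vertexEdge s ∈ edges G
  vertexEdge∈edges s = toVertices∈edges (proj₁ (edge-isEdge s)) (proj₂ (edge-isEdge s))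

theorem5p4 : (n : ℕ) (G : Graph (3 + n)) (pos : Fin (3 + n) → Fin (3 + n))
    → IsOuterplanarNearTriangulation pos G
    → CycleNeighbours pos (fromℕ (2 + n)) Fin.zero
    → CycleNeighbours pos Fin.zero (Fin.suc Fin.zero)
    → (α : Monomial (3 + n))
    → lookup α Fin.zero ≡ 0
    → lookup α (Fin.suc Fin.zero) ≡ 0
    → lookup α (fromℕ (2 + n)) ≡ 0
    → (∀ i → lookup α i ≤ 2)
    → coeff (graphPoly (deletePath G (fromℕ (2 + n)) Fin.zero (Fin.suc Fin.zero))) α ≡ + 0
-- Only the edge count matters, so where the deleted path lies on the outer cycle is irrelevant.
theorem5p4 n G pos ont _ _ α@(.0 ∷ .0 ∷ r) refl refl last≡0 α≤2 =
  coeff-homogeneous (graphPoly-homogeneous G′) α (ℕ.<⇒≢ degree<edges)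
  where
  G′ : Graph (3 + n)
  G′ = deletePath G (fromℕ (2 + n)) Fin.zero (Fin.suc Fin.zero)
  open ℕ.≤-Reasoning

  remaining-edges : (2 + n) + (1 + n) ≤ 2 + length (edges G′)
  remaining-edges = deletePath-edgeCount ont (fromℕ (2 + n)) Fin.zero (Fin.suc Fin.zero)

  degree<edges : degree α < length (edges G′)
  degree<edges = begin-strict
    degree α           ≤⟨ sum≤*-lastZero n r last≡0 (α≤2 ∘ Fin.suc ∘ Fin.suc) ⟩
    n ℕ.* 2            ≡⟨ ℕ.*-comm n 2 ⟩
    n + (n + 0)        <⟨ ℕ.+-monoʳ-< n (s≤s (ℕ.≤-reflexive (ℕ.+-identityʳ n))) ⟩
    n + suc n          ≤⟨ s≤s⁻¹ (s≤s⁻¹ remaining-edges) ⟩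
    length (edges G′)  ∎
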